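{- Let $n,s,\ell,c$ be positive integers with $n=2s+c=3s-\ell$ and $c,\ell\in\{1,\dots,s-1\}$, and let $d$ be a positive odd integer with $d\le 2c$. If $\mathcal{F}\subset 2^{[n]}$ is a shifted family with $d(\mathcal{F})=d$, then $$y_{\mathcal{F}}(2)\ge\min\Big\{\frac{(4\ell+3c+d-2)(3c-d+1)}{2},\ \frac{(\ell+3c-\frac{d-1}{2})(\ell+3c-\frac{d+1}{2})}{2}\Big\}.$$ Moreover, equality is achieved only if $\mathcal{F}^{(2)}=\binom{[2\ell+d-1]}{2}$ or $\mathcal{F}^{(2)}=\{F\in\binom{[n]}{2}: F\cap[\ell+\frac{d-1}{2}]\ne\emptyset\}$.
   Context: $[m]=\{1,\dots,m\}$, $[a,b]=\{a,\dots,b\}$. $\mathcal{F}^{(i)}=\mathcal{F}\cap\binom{[n]}{i}$ and $y_{\mathcal{F}}(i)=\binom{n}{i}-|\mathcal{F}^{(i)}|$. Shifts: for $a<b$, $S_{a\leftarrow b}(A)=(A\setminus\{b\})\cup\{a\}$ if $b\in A,a\notin A$, else $A$; $S_{a\leftarrow b}(\mathcal{F})=\{S_{a\leftarrow b}(A):A\in\mathcal{F}\}\cup\{A\in\mathcal{F}:S_{a\leftarrow b}(A)\in\mathcal{F}\}$; $\mathcal{F}$ is shifted if $S_{a\leftarrow b}(\mathcal{F})=\mathcal{F}$ for all $a<b$. $d(\mathcal{F})$ is the smallest integer $d\ge 0$ such that either ($d$ is even and for some $i\in[1,\ell+\frac d2]$ the set $\{i,2\ell+d+1-i\}\notin\mathcal{F}$)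 or ($d$ is odd and either $\{1,2\ell+d\}\notin\mathcal{F}$, or for some $i\in[3,\ell+\frac{d+1}{2}]$ the set $\{i,2\ell+d+2-i\}\notin\mathcal{F}$). -}

module Defs where

open import Data.Nat using (ℕ; zero; suc; _+_; _*_; _∸_; _≤_; _<_; _⊓_)
open import Data.Nat.DivMod using (_/_; _%_)
open import Data.Nat.Combinatorics using (_C_)
open import Data.Bool using (_≟_; Bool; true; false; _∧_; not; if_then_else_)
open import Data.Fin using (Fin; toℕ; _<?_)
open import Data.Fin.Subset using (Subset; ⁅_⁆; _∪_)
open import Data.Vec using (lookup; _[_]≔_)
open import Data.List using (List; length; filter; concatMap; map; allFin)
open import Data.Product using (Σ; _×_; proj₁; proj₂; ∃; _,_)
open import Data.Sum using (_⊎_)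
open import Relation.Nullary using (¬_; does)
open import Relation.Binary.PropositionalEquality using (_≡_)
open import Function.Bundles using (_⇔_)

-- A family of subsets of [n]; the ground set [n] = {1,…,n} is modelled by
-- Fin n, with element k ∈ Fin n standing for the integer toℕ k + 1.
-- A family is given by its (decidable) membership function.
Family : ℕ → Set
Family n = Subset n → Bool

_∈F_ : ∀ {n} → Subset n → Family n → Set
A ∈F F = F A ≡ true

shiftSet : ∀ {n} → Fin n → Fin n → Subset n → Subset n
shiftSet a b A =
  if lookup A b ∧ not (lookup A a) then ((A [ b ]≔ false) [ a ]≔ true) else A

InShift : ∀ {n} → Fin n → Fin n → Family n → Subset n → Set
InShift a b F B =
  (Σ (Subset _) λ A → A ∈F F × shiftSet a b A ≡ B) ⊎ (B ∈F F × shiftSet a b B ∈F F)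

Shifted : ∀ {n} → Family n → Set
Shifted {n} F = (a b : Fin n) → toℕ a < toℕ b →
  (B : Subset n) → InShift a b F B ⇔ (B ∈F F)

pair : ∀ {n} → Fin n → Fin n → Subset n
pair i j = ⁅ i ⁆ ∪ ⁅ j ⁆

-- {i, j} ∈ F for integers i, j (1-indexed); false if i or j ∉ [n].
PairIn : ∀ {n} → Family n → ℕ → ℕ → Set
PairIn {n} F i j = Σ (Fin n) λ i' → Σ (Fin n) λ j' →
  (suc (toℕ i') ≡ i) × (suc (toℕ j') ≡ j) × (pair i' j' ∈F F)

DCond : ∀ {n} → ℕ → Family n → ℕ → Set
DCond ℓ F d =
  (d % 2 ≡ 0 × ∃ λ i → 1 ≤ i × i ≤ ℓ + d / 2 × ¬ PairIn F i (2 * ℓ + d + 1 ∸ i))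
  ⊎ (d % 2 ≡ 1 ×
      (¬ PairIn F 1 (2 * ℓ + d)
       ⊎ ∃ λ i → 3 ≤ i × i ≤ ℓ + (d + 1) / 2 × ¬ PairIn F i (2 * ℓ + d + 2 ∸ i)))

DIs : ∀ {n} → ℕ → Family n → ℕ → Set
DIs ℓ F d = DCond ℓ F d × ((d' : ℕ) → d' < d → ¬ DCond ℓ F d')

pairs : (n : ℕ) → List (Fin n × Fin n)
pairs n = concatMap (λ i → map (λ j → (i , j)) (filter (λ j → i <? j) (allFin n))) (allFin n)

card2 : ∀ {n} → Family n → ℕ
card2 {n} F = length (filter (λ p → F (pair (proj₁ p) (proj₂ p)) ≟ true) (pairs n))

y2 : ∀ {n} → Family n → ℕ
y2 {n} F = (n C 2) ∸ card2 F

Level2IsInitial : ∀ {n} → Family n → ℕ → Set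
Level2IsInitial {n} F m = (i j : Fin n) → toℕ i < toℕ j →
  (pair i j ∈F F) ⇔ (suc (toℕ i) ≤ m × suc (toℕ j) ≤ m)

Level2HitsInitial : ∀ {n} → Family n → ℕ → Set
Level2HitsInitial {n} F k = (i j : Fin n) → toℕ i < toℕ j →
  (pair i j ∈F F) ⇔ (suc (toℕ i) ≤ k ⊎ suc (toℕ j) ≤ k)

module Submission where

-- Because F is shifted, its missing 2-sets form an up-set for the componentwise
-- order on pairs i < j: if {p, b} ∉ F then {i, j} ∉ F whenever p ≤ i and b ≤ j.  Hence every
-- missing pair {p, b} gives y_F(2) ≥ |U(p, b)|, the size of the up-set it generates, with
-- equality only if F^(2) is exactly the complement of U(p, b); in 0-based indices
-- 2|U(p, b)| + N = N(2q + N) where q = b − p and N = n − b.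
-- Write d = 2t + 1 and k = ℓ + t.  The condition defining d(F) = d says that {1, 2k + 1} or some
-- {i, 2k + 3 − i} with 3 ≤ i ≤ k + 1 is missing.  The pair {1, 2k + 1} gives the first term of the
-- bound, with equality only for F^(2) = binom([2k], 2); the pair {k + 1, k + 2} gives the second,
-- with equality only if the 2-sets of F are those meeting [k]; for 3 ≤ i ≤ k the up-set size is
-- concave in i and strictly exceeds one of these two values.

open import Defs
open import Data.Bool using (Bool; true; false; not; _∧_; _∨_; T)
open import Data.Bool.Properties using (∨-zeroʳ; ∨-identityʳ; ∧-zeroʳ; ∧-identityʳ; T-∧; T-not-≡) renaming (_≟_ to _≟ᵇ_)
open import Data.Empty using (⊥-elim)
open import Data.Fin using (Fin; toℕ; fromℕ<) renaming (zero to fzero; suc to fsuc)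
import Data.Fin.Properties as Fin
open import Data.Fin.Subset using (⁅_⁆)
open import Data.Fin.Subset.Properties using (∪-comm)
open import Data.List using (List; []; _∷_; length; map; filter; concatMap; allFin; tabulate)
open import Data.List.Membership.Propositional using (_∈_; lose)
open import Data.List.Membership.Propositional.Properties using (∈-concatMap⁺; ∈-concatMap⁻; ∈-map⁺; ∈-map⁻; ∈-filter⁺; ∈-filter⁻; ∈-allFin)
open import Data.List.Properties using (map-++; map-∘; map-cong; map-tabulate)
open import Data.List.Relation.Unary.Any using (here; there; satisfied)
open import Data.Nat using (ℕ; zero; suc; _+_; _*_; _∸_; _≤_; _<_; _⊓_; _≤ᵇ_; z≤n; s≤s)
open import Data.Nat.Combinatorics using (_C_; nC1≡n; nCk+nC[k+1]≡[n+1]C[k+1])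
open import Data.Nat.DivMod using (_/_; _%_; m*n/n≡m; [m+kn]%n≡m%n; m≡m%n+[m/n]*n)
open import Data.Nat.ListAction using (sum)
open import Data.Nat.ListAction.Properties using (sum-++)
open import Data.Nat.Properties
open import Algebra.Properties.CommutativeSemigroup +-commutativeSemigroup using () renaming (interchange to +-interchange)
open import Data.Nat.Tactic.RingSolver using (solve-∀)
open import Data.Product using (_×_; _,_; proj₁; proj₂)
open import Data.Sum using (_⊎_; inj₁; inj₂; [_,_]; [_,_]′)
open import Data.Vec using (Vec; lookup; _[_]≔_)
open import Data.Vec.Properties using (lookup∘update; lookup∘update′; lookup-zipWith; lookup-replicate; tabulate∘lookup; tabulate-cong)
open import Function using (_∘_; id; case_of_)
open import Function.Bundles using (_⇔_; mk⇔; Equivalence)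
open import Relation.Binary.PropositionalEquality using (_≡_; _≢_; refl; sym; trans; cong; cong₂; subst; subst₂; module ≡-Reasoning)
open import Relation.Nullary using (¬_; yes; no; does)
open import Relation.Nullary.Decidable using (dec-true; dec-false)
open import Relation.Unary using (Decidable)

-- Pairs in shifted families

lookup-⁅⁆ : ∀ {n} (u x : Fin n) → lookup ⁅ u ⁆ x ≡ does (u Fin.≟ x)
lookup-⁅⁆ fzero    fzero    = refl
lookup-⁅⁆ fzero    (fsuc x) = lookup-replicate x false
lookup-⁅⁆ (fsuc u) fzero    = refl
lookup-⁅⁆ (fsuc u) (fsuc x) = lookup-⁅⁆ u x

lookup-pair : ∀ {n} (u v x : Fin n) → lookup (pair u v) x ≡ does (u Fin.≟ x) ∨ does (v Fin.≟ x)
lookup-pair u v x = trans (lookup-zipWith _∨_ x ⁅ u ⁆ ⁅ v ⁆) (cong₂ _∨_ (lookup-⁅⁆ u x) (lookup-⁅⁆ v x))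

pair-comm : ∀ {n} (u v : Fin n) → pair u v ≡ pair v u
pair-comm u v = ∪-comm ⁅ u ⁆ ⁅ v ⁆

lookup-ext : ∀ {A : Set} {n} {xs ys : Vec A n} → (∀ x → lookup xs x ≡ lookup ys x) → xs ≡ ys
lookup-ext {xs = xs} {ys} eq = trans (sym (tabulate∘lookup xs)) (trans (tabulate-cong eq) (tabulate∘lookup ys))

shiftSet-pair : ∀ {n} {u a b : Fin n} → u ≢ a → u ≢ b → a ≢ b → shiftSet a b (pair u b) ≡ pair u a
shiftSet-pair {u = u} {a} {b} u≢a u≢b a≢b
  rewrite lookup-pair u b b | lookup-pair u b a
        | dec-true (b Fin.≟ b) refl | dec-false (u Fin.≟ a) u≢a | dec-false (b Fin.≟ a) (a≢b ∘ sym)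
        | ∨-zeroʳ (does (u Fin.≟ b)) = lookup-ext pointwise
  where
  open ≡-Reasoning
  B = pair u b [ b ]≔ false
  pointwise : ∀ x → lookup (B [ a ]≔ true) x ≡ lookup (pair u a) x
  pointwise x rewrite lookup-pair u a x with a Fin.≟ x | b Fin.≟ x
  ... | yes refl | _        = trans (lookup∘update a B true) (sym (∨-zeroʳ _))
  ... | no a≢x   | yes refl = begin
    lookup (B [ a ]≔ true) b  ≡⟨ lookup∘update′ (a≢x ∘ sym) B true ⟩
    lookup B b                ≡⟨ lookup∘update b (pair u b) false ⟩
    false                     ≡⟨ dec-false (u Fin.≟ b) u≢b ⟨
    does (u Fin.≟ b)          ≡⟨ ∨-identityʳ _ ⟨
    does (u Fin.≟ b) ∨ false  ∎
  ... | no a≢x   | no b≢x   = begin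
    lookup (B [ a ]≔ true) x                ≡⟨ lookup∘update′ (a≢x ∘ sym) B true ⟩
    lookup B x                              ≡⟨ lookup∘update′ (b≢x ∘ sym) (pair u b) false ⟩
    lookup (pair u b) x                     ≡⟨ lookup-pair u b x ⟩
    does (u Fin.≟ x) ∨ does (b Fin.≟ x)     ≡⟨ cong (does (u Fin.≟ x) ∨_) (dec-false (b Fin.≟ x) b≢x) ⟩
    does (u Fin.≟ x) ∨ false                ∎

module _ {n} {F : Family n} (shifted : Shifted F) where

  pair-lowerʳ : ∀ {u a b : Fin n} → toℕ a ≤ toℕ b → u ≢ a → u ≢ b → pair u b ∈F F → pair u a ∈F F
  pair-lowerʳ {u} {a} {b} a≤b u≢a u≢b ub∈F with m≤n⇒m<n∨m≡n a≤b
  ... | inj₂ a≡b rewrite Fin.toℕ-injective a≡b = ub∈F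
  ... | inj₁ a<b = Equivalence.to (shifted a b a<b (pair u a))
                     (inj₁ (pair u b , ub∈F , shiftSet-pair u≢a u≢b (Fin.<⇒≢ a<b)))

  pair-lower : ∀ {x y x′ y′ : Fin n} → toℕ x′ ≤ toℕ x → toℕ y′ ≤ toℕ y →
               toℕ x′ < toℕ y′ → toℕ x < toℕ y → pair x y ∈F F → pair x′ y′ ∈F F
  pair-lower {x} {y} {x′} {y′} x′≤x y′≤y x′<y′ x<y xy∈F =
    pair-lowerʳ y′≤y (Fin.<⇒≢ x′<y′) (Fin.<⇒≢ (<-≤-trans x′<y′ y′≤y)) x′y∈F
    where
    x′y∈F : pair x′ y ∈F F
    x′y∈F = subst (_∈F F) (pair-comm y x′)
      (pair-lowerʳ x′≤x (Fin.<⇒≢ (≤-<-trans x′≤x x<y) ∘ sym) (Fin.<⇒≢ x<y ∘ sym)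
        (subst (_∈F F) (pair-comm x y) xy∈F))

-- Finite sums and counting

𝟙 : Bool → ℕ
𝟙 true  = 1
𝟙 false = 0

∑< : ℕ → (ℕ → ℕ) → ℕ
∑< zero    f = 0
∑< (suc n) f = ∑< n f + f n

syntax ∑< n (λ i → e) = ∑[ i < n ] e

∑<-cong : ∀ n {f g : ℕ → ℕ} → (∀ i → i < n → f i ≡ g i) → ∑< n f ≡ ∑< n g
∑<-cong zero    eq = refl
∑<-cong (suc n) eq = cong₂ _+_ (∑<-cong n (λ i i<n → eq i (m<n⇒m<1+n i<n))) (eq n ≤-refl)

∑<-zero : ∀ n {f : ℕ → ℕ} → (∀ i → i < n → f i ≡ 0) → ∑< n f ≡ 0
∑<-zero zero    eq = refl
∑<-zero (suc n) eq = cong₂ _+_ (∑<-zero n (λ i i<n → eq i (m<n⇒m<1+n i<n))) (eq n ≤-refl)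

∑<-distrib-+ : ∀ n (f g : ℕ → ℕ) → ∑[ i < n ] (f i + g i) ≡ ∑< n f + ∑< n g
∑<-distrib-+ zero    f g = refl
∑<-distrib-+ (suc n) f g = trans (cong (_+ (f n + g n)) (∑<-distrib-+ n f g)) (+-interchange (∑< n f) _ (f n) _)

∑<-head : ∀ n (f : ℕ → ℕ) → ∑< (suc n) f ≡ f 0 + ∑[ i < n ] f (suc i)
∑<-head zero    f = +-comm 0 (f 0)
∑<-head (suc n) f = trans (cong (_+ f (suc n)) (∑<-head n f)) (+-assoc (f 0) _ _)

count≥ : ∀ p j → ∑[ i < j ] 𝟙 (p ≤ᵇ i) ≡ j ∸ p
count≥ p zero = sym (0∸n≡0 p)
count≥ p (suc j) with p ≤? j
... | yes p≤j = trans (cong₂ _+_ (count≥ p j) (cong 𝟙 (dec-true (p ≤? j) p≤j)))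
                      (trans (+-comm (j ∸ p) 1) (sym (+-∸-assoc 1 p≤j)))
... | no p≰j  = trans (cong₂ _+_ (count≥ p j) (cong 𝟙 (dec-false (p ≤? j) p≰j)))
                      (trans (+-identityʳ _) (trans (m≤n⇒m∸n≡0 (<⇒≤ p>j)) (sym (m≤n⇒m∸n≡0 p>j))))
  where p>j = ≰⇒> p≰j

countᵇ : ∀ {A : Set} → (A → Bool) → List A → ℕ
countᵇ P xs = sum (map (𝟙 ∘ P) xs)

sum-map-concatMap : ∀ {A B : Set} (g : B → ℕ) (f : A → List B) xs →
                    sum (map g (concatMap f xs)) ≡ sum (map (λ x → sum (map g (f x))) xs)
sum-map-concatMap g f []       = refl
sum-map-concatMap g f (x ∷ xs) =
  trans (cong sum (map-++ g (f x) (concatMap f xs)))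
        (trans (sum-++ (map g (f x)) _) (cong (sum (map g (f x)) +_) (sum-map-concatMap g f xs)))

countᵇ-filter : ∀ {A : Set} {P : A → Set} (P? : Decidable P) (Q : A → Bool) xs →
                countᵇ Q (filter P? xs) ≡ countᵇ (λ x → does (P? x) ∧ Q x) xs
countᵇ-filter P? Q []       = refl
countᵇ-filter P? Q (x ∷ xs) with does (P? x)
... | true  = cong (𝟙 (Q x) +_) (countᵇ-filter P? Q xs)
... | false = countᵇ-filter P? Q xs

sum-map-allFin : ∀ n (g : ℕ → ℕ) → sum (map (g ∘ toℕ) (allFin n)) ≡ ∑< n g
sum-map-allFin n g = trans (cong sum (map-tabulate {n = n} id (g ∘ toℕ))) (sum-tabulate n g)
  where
  sum-tabulate : ∀ n (g : ℕ → ℕ) → sum (tabulate {n = n} (g ∘ toℕ)) ≡ ∑< n g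
  sum-tabulate zero    g = refl
  sum-tabulate (suc n) g = trans (cong (g 0 +_) (sum-tabulate n (g ∘ suc))) (sym (∑<-head n g))

𝟙-mono : ∀ {x y} → (T x → T y) → 𝟙 x ≤ 𝟙 y
𝟙-mono {false}         _   = z≤n
𝟙-mono {true}  {true}  _   = ≤-refl
𝟙-mono {true}  {false} x⇒y = ⊥-elim (x⇒y _)

𝟙-reflects : ∀ {x y} → 𝟙 x ≤ 𝟙 y → T x → T y
𝟙-reflects {true} {true} _ _ = _

+-mono-≤-tight : ∀ {a b c d} → a ≤ b → c ≤ d → b + d ≤ a + c → b ≤ a × d ≤ c
+-mono-≤-tight {a} {b} {c} {d} a≤b c≤d b+d≤a+c =
  +-cancelʳ-≤ d b a (≤-trans b+d≤a+c (+-monoʳ-≤ a c≤d)) ,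
  +-cancelˡ-≤ a d c (≤-trans (+-monoˡ-≤ d a≤b) b+d≤a+c)

module _ {A : Set} (f g : A → ℕ) where

  sum-map-mono : ∀ {xs} → (∀ {x} → x ∈ xs → f x ≤ g x) → sum (map f xs) ≤ sum (map g xs)
  sum-map-mono {[]}     f≤g = z≤n
  sum-map-mono {x ∷ xs} f≤g = +-mono-≤ (f≤g (here refl)) (sum-map-mono (f≤g ∘ there))

  sum-map-tight : ∀ {xs} → (∀ {x} → x ∈ xs → f x ≤ g x) → sum (map g xs) ≤ sum (map f xs) →
                  ∀ {x} → x ∈ xs → g x ≤ f x
  sum-map-tight {x ∷ xs} f≤g Σg≤Σf x∈ =
    let (gx≤fx , Σg≤Σf′) = +-mono-≤-tight (f≤g (here refl)) (sum-map-mono (f≤g ∘ there)) Σg≤Σf in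
    case x∈ of λ where
      (here refl) → gx≤fx
      (there x∈′) → sum-map-tight (f≤g ∘ there) Σg≤Σf′ x∈′

module _ {A : Set} (P Q : A → Bool) where

  countᵇ-mono : ∀ {xs} → (∀ {x} → x ∈ xs → T (Q x) → T (P x)) → countᵇ Q xs ≤ countᵇ P xs
  countᵇ-mono Q⇒P = sum-map-mono (𝟙 ∘ Q) (𝟙 ∘ P) (𝟙-mono ∘ Q⇒P)

  countᵇ-tight : ∀ {xs} → (∀ {x} → x ∈ xs → T (Q x) → T (P x)) → countᵇ P xs ≤ countᵇ Q xs →
                 ∀ {x} → x ∈ xs → T (P x) → T (Q x)
  countᵇ-tight Q⇒P #P≤#Q x∈ =
    𝟙-reflects (sum-map-tight (𝟙 ∘ Q) (𝟙 ∘ P) (𝟙-mono ∘ Q⇒P) #P≤#Q x∈)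

countᵇ+countᵇ-not : ∀ {A : Set} (P : A → Bool) xs → countᵇ P xs + countᵇ (not ∘ P) xs ≡ length xs
countᵇ+countᵇ-not P []       = refl
countᵇ+countᵇ-not P (x ∷ xs) with P x
... | true  = cong suc (countᵇ+countᵇ-not P xs)
... | false = trans (+-suc _ _) (cong suc (countᵇ+countᵇ-not P xs))

length-filter-≟true : ∀ {A : Set} (P : A → Bool) xs → length (filter (λ x → P x ≟ᵇ true) xs) ≡ countᵇ P xs
length-filter-≟true P []       = refl
length-filter-≟true P (x ∷ xs) with P x
... | true  = cong suc (length-filter-≟true P xs)
... | false = length-filter-≟true P xs

-- Counting 2-sets

#pairs : ℕ → (ℕ → ℕ → Bool) → ℕ
#pairs n P = ∑[ j < n ] ∑[ i < j ] 𝟙 (P i j)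

∑-triangle : ∀ n (P : ℕ → ℕ → Bool) → ∑[ a < n ] ∑[ b < n ] 𝟙 (does (a <? b) ∧ P a b) ≡ #pairs n P
∑-triangle zero    P = refl
∑-triangle (suc n) P = begin
  ∑[ a < n ] ∑[ b < suc n ] R a b + ∑[ b < suc n ] R n b
    ≡⟨ cong₂ _+_
         (∑<-cong n (λ a a<n → cong (λ x → ∑< n (R a) + 𝟙 (x ∧ P a n)) (dec-true (a <? n) a<n)))
         (∑<-zero (suc n) (λ b b<1+n →
           cong (λ x → 𝟙 (x ∧ P n b)) (dec-false (n <? b) (≤⇒≯ (≤-pred b<1+n))))) ⟩
  ∑[ a < n ] (∑< n (R a) + 𝟙 (P a n)) + 0
    ≡⟨ +-identityʳ _ ⟩
  ∑[ a < n ] (∑< n (R a) + 𝟙 (P a n))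
    ≡⟨ ∑<-distrib-+ n _ _ ⟩
  ∑[ a < n ] ∑< n (R a) + ∑[ a < n ] 𝟙 (P a n)
    ≡⟨ cong (_+ ∑[ a < n ] 𝟙 (P a n)) (∑-triangle n P) ⟩
  #pairs (suc n) P ∎
  where
  open ≡-Reasoning
  R : ℕ → ℕ → ℕ
  R a b = 𝟙 (does (a <? b) ∧ P a b)

pairRow : ∀ {n} → Fin n → List (Fin n × Fin n)
pairRow {n} i = map (i ,_) (filter (i Fin.<?_) (allFin n))

module _ {n : ℕ} where

  ∈-pairs⁺ : ∀ {i j : Fin n} → toℕ i < toℕ j → (i , j) ∈ pairs n
  ∈-pairs⁺ {i} {j} i<j =
    ∈-concatMap⁺ pairRow (lose (∈-allFin i) (∈-map⁺ (i ,_) (∈-filter⁺ (i Fin.<?_) (∈-allFin j) i<j)))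

  ∈-pairs⁻ : ∀ {i j : Fin n} → (i , j) ∈ pairs n → toℕ i < toℕ j
  ∈-pairs⁻ ij∈ with satisfied (∈-concatMap⁻ pairRow {xs = allFin n} ij∈)
  ... | i , ij∈row with ∈-map⁻ (i ,_) ij∈row
  ... | j , j∈ , refl = proj₂ (∈-filter⁻ (i Fin.<?_) {xs = allFin n} j∈)

countᵇ-pairs : ∀ n (P : ℕ → ℕ → Bool) →
               countᵇ (λ (i , j) → P (toℕ i) (toℕ j)) (pairs n) ≡ #pairs n P
countᵇ-pairs n P = begin
  countᵇ P′ (pairs n)
    ≡⟨ sum-map-concatMap (𝟙 ∘ P′) pairRow (allFin n) ⟩
  sum (map (λ i → countᵇ P′ (pairRow i)) (allFin n))
    ≡⟨ cong sum (map-cong row-count (allFin n)) ⟩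
  sum (map (rowSum ∘ toℕ) (allFin n))
    ≡⟨ sum-map-allFin n rowSum ⟩
  ∑< n rowSum
    ≡⟨ ∑-triangle n P ⟩
  #pairs n P ∎
  where
  open ≡-Reasoning
  P′ : Fin n × Fin n → Bool
  P′ (i , j) = P (toℕ i) (toℕ j)
  rowSum : ℕ → ℕ
  rowSum a = ∑[ b < n ] 𝟙 (does (a <? b) ∧ P a b)
  row-count : ∀ i → countᵇ P′ (pairRow i) ≡ rowSum (toℕ i)
  row-count i = begin
    countᵇ P′ (pairRow i)
      ≡⟨ cong sum (map-∘ (filter (i Fin.<?_) (allFin n))) ⟨
    countᵇ (P′ ∘ (i ,_)) (filter (i Fin.<?_) (allFin n))
      ≡⟨ countᵇ-filter (i Fin.<?_) (P′ ∘ (i ,_)) (allFin n) ⟩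
    sum (map (λ j → 𝟙 (does (i Fin.<? j) ∧ P (toℕ i) (toℕ j))) (allFin n))
      ≡⟨ sum-map-allFin n (λ b → 𝟙 (does (toℕ i <? b) ∧ P (toℕ i) b)) ⟩
    rowSum (toℕ i) ∎

#pairs-true : ∀ n → #pairs n (λ _ _ → true) ≡ n C 2
#pairs-true zero    = refl
#pairs-true (suc n) = begin
  #pairs n (λ _ _ → true) + ∑[ i < n ] 1  ≡⟨ cong₂ _+_ (#pairs-true n) (count≥ 0 n) ⟩
  n C 2 + n                               ≡⟨ +-comm (n C 2) n ⟩
  n + n C 2                               ≡⟨ cong (_+ n C 2) (nC1≡n n) ⟨
  n C 1 + n C 2                           ≡⟨ nCk+nC[k+1]≡[n+1]C[k+1] n 1 ⟩
  suc n C 2                               ∎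
  where open ≡-Reasoning

length-pairs : ∀ n → length (pairs n) ≡ n C 2
length-pairs n = trans (sym (countᵇ-true (pairs n))) (trans (countᵇ-pairs n (λ _ _ → true)) (#pairs-true n))
  where
  countᵇ-true : ∀ {A : Set} (xs : List A) → countᵇ (λ _ → true) xs ≡ length xs
  countᵇ-true []       = refl
  countᵇ-true (x ∷ xs) = cong suc (countᵇ-true xs)

module _ {n} (F : Family n) where

  F² : Fin n × Fin n → Bool
  F² (i , j) = F (pair i j)

  y2≡#missing : y2 F ≡ countᵇ (not ∘ F²) (pairs n)
  y2≡#missing = begin
    n C 2 ∸ card2 F
      ≡⟨ cong₂ _∸_ (sym (length-pairs n)) (length-filter-≟true F² (pairs n)) ⟩
    length (pairs n) ∸ countᵇ F² (pairs n)
      ≡⟨ cong (_∸ countᵇ F² (pairs n)) (countᵇ+countᵇ-not F² (pairs n)) ⟨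
    countᵇ F² (pairs n) + countᵇ (not ∘ F²) (pairs n) ∸ countᵇ F² (pairs n)
      ≡⟨ m+n∸m≡n (countᵇ F² (pairs n)) _ ⟩
    countᵇ (not ∘ F²) (pairs n) ∎
    where open ≡-Reasoning

-- Up-sets of pairs

upset : ℕ → ℕ → ℕ → ℕ → Bool
upset p b i j = (p ≤ᵇ i) ∧ (b ≤ᵇ j)

T-upset : ∀ {p b i j} → T (upset p b i j) ⇔ (p ≤ i × b ≤ j)
T-upset {p} {b} {i} {j} = mk⇔
  (λ t → let (tp , tb) = Equivalence.to T-∧ t in ≤ᵇ⇒≤ p i tp , ≤ᵇ⇒≤ b j tb)
  (λ (p≤i , b≤j) → Equivalence.from T-∧ (≤⇒≤ᵇ p≤i , ≤⇒≤ᵇ b≤j))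

upset-column-below : ∀ p {b j} → j < b → ∑[ i < j ] 𝟙 (upset p b i j) ≡ 0
upset-column-below p {b} {j} j<b = ∑<-zero j λ i _ →
  cong 𝟙 (trans (cong ((p ≤ᵇ i) ∧_) (dec-false (b ≤? j) (<⇒≱ j<b))) (∧-zeroʳ _))

upset-column-above : ∀ p {b j} → b ≤ j → ∑[ i < j ] 𝟙 (upset p b i j) ≡ j ∸ p
upset-column-above p {b} {j} b≤j = trans (∑<-cong j λ i _ →
  cong 𝟙 (trans (cong ((p ≤ᵇ i) ∧_) (dec-true (b ≤? j) b≤j)) (∧-identityʳ _))) (count≥ p j)

#pairs-upset-below : ∀ p {b j} → j ≤ b → #pairs j (upset p b) ≡ 0
#pairs-upset-below p {b} {j} j≤b = ∑<-zero j λ j′ j′<j → upset-column-below p (<-≤-trans j′<j j≤b)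

#pairs-upset : ∀ p q N → 2 * #pairs (p + q + N) (upset p (p + q)) + N ≡ N * (2 * q + N)
#pairs-upset p q zero rewrite +-identityʳ (p + q) | #pairs-upset-below p {p + q} ≤-refl = refl
#pairs-upset p q (suc N) rewrite +-suc (p + q) N = begin
  2 * (#pairs M U + ∑[ i < M ] 𝟙 (U i M)) + suc N
    ≡⟨ cong (λ x → 2 * (#pairs M U + x) + suc N) (upset-column-above p (m≤m+n (p + q) N)) ⟩
  2 * (#pairs M U + (M ∸ p)) + suc N
    ≡⟨ cong (λ x → 2 * (#pairs M U + x) + suc N) (trans (cong (_∸ p) (+-assoc p q N)) (m+n∸m≡n p (q + N))) ⟩
  2 * (#pairs M U + (q + N)) + suc N
    ≡⟨ regroup (#pairs M U) q N ⟩
  (2 * #pairs M U + N) + suc (2 * q + 2 * N)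
    ≡⟨ cong (_+ suc (2 * q + 2 * N)) (#pairs-upset p q N) ⟩
  N * (2 * q + N) + suc (2 * q + 2 * N)
    ≡⟨ complete-square q N ⟩
  suc N * (2 * q + suc N) ∎
  where
  open ≡-Reasoning
  M = p + q + N
  U = upset p (p + q)
  regroup : ∀ R q N → 2 * (R + (q + N)) + suc N ≡ (2 * R + N) + suc (2 * q + 2 * N)
  regroup = solve-∀
  complete-square : ∀ q N → N * (2 * q + N) + suc (2 * q + 2 * N) ≡ suc N * (2 * q + suc N)
  complete-square = solve-∀

twice-#pairs-upset : ∀ {n} p q N {X} → n ≡ p + q + N → X + N ≡ N * (2 * q + N) →
                     2 * #pairs n (upset p (p + q)) ≡ X
twice-#pairs-upset p q N {X} refl X+N≡ = +-cancelʳ-≡ N _ X (trans (#pairs-upset p q N) (sym X+N≡))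

-- p and b are 0-based indices, whereas PairIn is 1-based.
module MissingPair {n} {F : Family n} (shifted : Shifted F) {p b : ℕ} (p<b : p < b) (b<n : b < n)
                   (pb∉F : ¬ PairIn F (suc p) (suc b)) where

  private
    U : Fin n × Fin n → Bool
    U (i , j) = upset p b (toℕ i) (toℕ j)

  upset⇒missing : ∀ {x} → x ∈ pairs n → T (U x) → T (not (F² F x))
  upset⇒missing {i , j} ij∈ up with F (pair i j) in ij∈F
  ... | false = _
  ... | true  = pb∉F (p′ , b′ , cong suc p′≡p , cong suc b′≡b ,
                      pair-lower shifted (subst (_≤ toℕ i) (sym p′≡p) p≤i)
                        (subst (_≤ toℕ j) (sym b′≡b) b≤j)
                        (subst₂ _<_ (sym p′≡p) (sym b′≡b) p<b) (∈-pairs⁻ ij∈) ij∈F)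
    where
    p′ = fromℕ< (<-trans p<b b<n)
    b′ = fromℕ< b<n
    p′≡p = Fin.toℕ-fromℕ< (<-trans p<b b<n)
    b′≡b = Fin.toℕ-fromℕ< b<n
    p≤i = proj₁ (Equivalence.to (T-upset {p} {b}) up)
    b≤j = proj₂ (Equivalence.to (T-upset {p} {b}) up)

  #upset≤y2 : #pairs n (upset p b) ≤ y2 F
  #upset≤y2 = subst₂ _≤_ (countᵇ-pairs n (upset p b)) (sym (y2≡#missing F))
                (countᵇ-mono (not ∘ F² F) U upset⇒missing)

  y2≤#upset⇒level2 : y2 F ≤ #pairs n (upset p b) →
    ∀ (i j : Fin n) → toℕ i < toℕ j → pair i j ∈F F ⇔ (toℕ i < p ⊎ toℕ j < b)
  y2≤#upset⇒level2 y2≤# i j i<j = mk⇔ to from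
    where
    missing⇒upset : T (not (F (pair i j))) → T (U (i , j))
    missing⇒upset = countᵇ-tight (not ∘ F² F) U upset⇒missing
      (subst₂ _≤_ (y2≡#missing F) (sym (countᵇ-pairs n (upset p b))) y2≤#) (∈-pairs⁺ i<j)
    to : pair i j ∈F F → toℕ i < p ⊎ toℕ j < b
    to ij∈F with p ≤? toℕ i | b ≤? toℕ j
    ... | yes p≤i | yes b≤j = ⊥-elim (subst (T ∘ not) ij∈F
                                 (upset⇒missing (∈-pairs⁺ i<j) (Equivalence.from T-upset (p≤i , b≤j))))
    ... | no p≰i  | _       = inj₁ (≰⇒> p≰i)
    ... | yes _   | no b≰j  = inj₂ (≰⇒> b≰j)
    from : toℕ i < p ⊎ toℕ j < b → pair i j ∈F F
    from below with F (pair i j) in ij∉F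
    ... | true  = refl
    ... | false with Equivalence.to T-upset (missing⇒upset (Equivalence.from T-not-≡ ij∉F))
    ...   | p≤i , b≤j = ⊥-elim ([ (λ i<p → <⇒≱ i<p p≤i) , (λ j<b → <⇒≱ j<b b≤j) ] below)

-- The bound for odd d

-- The three products are 2|U| for the missing pairs {1, 2k+1}, {k+1, k+2} and {w+1, w+2u+2}.
-- With N = A + w the last exceeds the second by u(2N − u − 1) and the first by
-- w(3w − 2N − 3) + 4u(w − 1); the case split is on the sign of 2N − u − 1.
interior-exceeds-ends : ∀ A k w u → k ≡ w + u → 2 ≤ w → 1 ≤ u →
  let X = (A + w) * (A + w + 4 * u + 1) in
  suc A * (A + 4 * k) < X ⊎ (A + k) * suc (A + k) < X
interior-exceeds-ends A _ w@(suc (suc w′)) u@(suc _) refl (s≤s (s≤s _)) (s≤s _) with 2 * (A + w) ≤? suc u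
... | yes 2N≤1+u = inj₁ (+-cancelʳ-< (w * suc u) _ _ (begin-strict
  suc A * (A + 4 * k) + w * suc u                            <⟨ +-monoˡ-< (w * suc u) (m<m+n _ (s≤s z≤n)) ⟩
  suc A * (A + 4 * k) + (2 + 3 * w′) * k + w * suc u         ≡⟨ identity A w′ u ⟩
  (A + w) * (A + w + 4 * u + 1) + w * (2 * (A + w))          ≤⟨ +-monoʳ-≤ _ (*-monoʳ-≤ w 2N≤1+u) ⟩
  (A + w) * (A + w + 4 * u + 1) + w * suc u                  ∎))
  where
  open ≤-Reasoning
  k = w + u
  identity : ∀ A w′ u → let w = 2 + w′; k = w + u in
    suc A * (A + 4 * k) + (2 + 3 * w′) * k + w * suc u ≡ (A + w) * (A + w + 4 * u + 1) + w * (2 * (A + w))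
  identity = solve-∀
... | no 2N≰1+u = inj₂ (+-cancelʳ-< (u * suc u) _ _ (begin-strict
  (A + k) * suc (A + k) + u * suc u                          <⟨ +-monoʳ-< _ (*-monoʳ-< u (≰⇒> 2N≰1+u)) ⟩
  (A + k) * suc (A + k) + u * (2 * (A + w))                  ≡⟨ identity A w u ⟨
  (A + w) * (A + w + 4 * u + 1) + u * suc u                  ∎))
  where
  open ≤-Reasoning
  k = w + u
  identity : ∀ A w u → let k = w + u in
    (A + w) * (A + w + 4 * u + 1) + u * suc u ≡ (A + k) * suc (A + k) + u * (2 * (A + w))
  identity = solve-∀

+⇒∸ : ∀ {a} b c → a ≡ b + c → a ∸ c ≡ b
+⇒∸ b c refl = m+n∸n≡m b c

[1+2t+1]/2≡1+t : ∀ t → (1 + t * 2 + 1) / 2 ≡ suc t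
[1+2t+1]/2≡1+t t = trans (cong (_/ 2) (+-comm (1 + t * 2) 1)) (m*n/n≡m (suc t) 2)

TightY2Bound : ∀ {n} → Family n → ℕ → ℕ → ℕ → Set
TightY2Bound F m a b = m ≤ y2 F × (y2 F ≡ m → Level2IsInitial F a ⊎ Level2HitsInitial F b)

module _ {n} (F : Family n) {m a b : ℕ} where

  tight-via : ∀ {R} → m ≤ R → R ≤ y2 F → (y2 F ≤ R → Level2IsInitial F a ⊎ Level2HitsInitial F b) →
              TightY2Bound F m a b
  tight-via m≤R R≤y2 y2≤R⇒ =
    ≤-trans m≤R R≤y2 , λ y2≡m → y2≤R⇒ (≤-trans (≤-reflexive y2≡m) m≤R)

  tight-strict : m < y2 F → TightY2Bound F m a b
  tight-strict m<y2 = <⇒≤ m<y2 , λ y2≡m → ⊥-elim (<-irrefl (sym y2≡m) m<y2)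

-- Here d = 2t + 1, k = ℓ + t and A = n − 2k − 1; RA and RB are the two terms of the bound.
module OddCase {n} {F : Family n} (shifted : Shifted F) (ℓ t A : ℕ) (0<ℓ : 0 < ℓ)
               (n≡ : n ≡ 2 * (ℓ + t) + suc A) where

  k : ℕ
  k = ℓ + t

  RA RB : ℕ
  RA = #pairs n (upset 0 (2 * k))
  RB = #pairs n (upset k (k + 1))

  2RA≡ : 2 * RA ≡ suc A * (A + 4 * k)
  2RA≡ = twice-#pairs-upset 0 (2 * k) (suc A) n≡ (identity A k)
    where
    identity : ∀ A k → suc A * (A + 4 * k) + suc A ≡ suc A * (2 * (2 * k) + suc A)
    identity = solve-∀

  n≡B : n ≡ k + 1 + (A + k)
  n≡B = trans n≡ (regroup k A)
    where
    regroup : ∀ k A → 2 * k + suc A ≡ k + 1 + (A + k)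
    regroup = solve-∀

  2RB≡ : 2 * RB ≡ (A + k) * suc (A + k)
  2RB≡ = twice-#pairs-upset k 1 (A + k) n≡B (identity (A + k))
    where
    identity : ∀ N → N * suc N + N ≡ N * (2 * 1 + N)
    identity = solve-∀

  0<k : 0 < k
  0<k = <-≤-trans 0<ℓ (m≤m+n ℓ t)

  p+q<n : ∀ {p q N} → 0 < N → n ≡ p + q + N → p + q < n
  p+q<n {p} {q} 0<N n≡′ = subst (p + q <_) (sym n≡′) (m<m+n (p + q) 0<N)

  caseA : ¬ PairIn F 1 (suc (2 * k)) → TightY2Bound F (RA ⊓ RB) (2 * k) k
  caseA ∉F = tight-via F (m⊓n≤m RA RB) #upset≤y2 (inj₁ ∘ initial)
    where
    open MissingPair shifted {0} {2 * k} (<-≤-trans 0<k (m≤m+n k _)) (p+q<n {0} (s≤s z≤n) n≡) ∉F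
    initial : y2 F ≤ RA → Level2IsInitial F (2 * k)
    initial y2≤RA i j i<j = mk⇔ (λ ij∈F → [ (λ ()) , (λ j<2k → <-trans i<j j<2k , j<2k) ] (to ij∈F))
                                (λ (_ , j<2k) → from (inj₂ j<2k))
      where open Equivalence (y2≤#upset⇒level2 y2≤RA i j i<j)

  caseB : ¬ PairIn F (suc k) (suc (k + 1)) → TightY2Bound F (RA ⊓ RB) (2 * k) k
  caseB ∉F = tight-via F (m⊓n≤n RA RB) #upset≤y2 (inj₂ ∘ hits)
    where
    open MissingPair shifted {k} {k + 1} (m<m+n k (s≤s z≤n)) (p+q<n {k} (<-≤-trans 0<k (m≤n+m k A)) n≡B) ∉F
    hits : y2 F ≤ RB → Level2HitsInitial F k
    hits y2≤RB i j i<j = mk⇔ (inj₁ ∘ [ id , j<k+1⇒i<k ] ∘ to) (from ∘ inj₁ ∘ [ id , <-trans i<j ])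
      where
      open Equivalence (y2≤#upset⇒level2 y2≤RB i j i<j)
      j<k+1⇒i<k : toℕ j < k + 1 → toℕ i < k
      j<k+1⇒i<k j<k+1 = <-≤-trans i<j (m<1+n⇒m≤n (subst (toℕ j <_) (+-comm k 1) j<k+1))

  caseX : ∀ {w u} → 2 ≤ w → 1 ≤ u → k ≡ w + u → ¬ PairIn F (suc w) (suc (w + suc (2 * u))) →
          TightY2Bound F (RA ⊓ RB) (2 * k) k
  caseX {w} {u} 2≤w 1≤u k≡ ∉F = tight-strict F (<-≤-trans min<RX #upset≤y2)
    where
    n≡X : n ≡ w + suc (2 * u) + (A + w)
    n≡X = trans n≡ (trans (cong (λ k → 2 * k + suc A) k≡) (regroup w u A))
      where
      regroup : ∀ w u A → 2 * (w + u) + suc A ≡ w + suc (2 * u) + (A + w)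
      regroup = solve-∀
    open MissingPair shifted {w} {w + suc (2 * u)} (m<m+n w (s≤s z≤n))
                     (p+q<n {w} (<-≤-trans (<-≤-trans (s≤s z≤n) 2≤w) (m≤n+m w A)) n≡X) ∉F
    RX = #pairs n (upset w (w + suc (2 * u)))
    2RX≡ : 2 * RX ≡ (A + w) * (A + w + 4 * u + 1)
    2RX≡ = twice-#pairs-upset w (suc (2 * u)) (A + w) n≡X (identity (A + w) u)
      where
      identity : ∀ N u → N * (N + 4 * u + 1) + N ≡ N * (2 * suc (2 * u) + N)
      identity = solve-∀
    min<RX : RA ⊓ RB < RX
    min<RX = [ (λ lt → ≤-<-trans (m⊓n≤m RA RB) (*-cancelˡ-< 2 RA RX (subst₂ _<_ (sym 2RA≡) (sym 2RX≡) lt)))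
             , (λ lt → ≤-<-trans (m⊓n≤n RA RB) (*-cancelˡ-< 2 RB RX (subst₂ _<_ (sym 2RB≡) (sym 2RX≡) lt)))
             ]′ (interior-exceeds-ends A k w u k≡ 2≤w 1≤u)

  private
    first-partner : 2 * ℓ + (1 + t * 2) ≡ suc (2 * k)
    first-partner = identity ℓ t
      where
      identity : ∀ ℓ t → 2 * ℓ + (1 + t * 2) ≡ suc (2 * (ℓ + t))
      identity = solve-∀

    partner : ∀ {w u} → w + u ≡ k → 2 * ℓ + (1 + t * 2) + 2 ∸ suc w ≡ suc (w + suc (2 * u))
    partner {w} {u} w+u≡k = +⇒∸ (suc (w + suc (2 * u))) (suc w) (begin
      2 * ℓ + (1 + t * 2) + 2          ≡⟨ identity₁ ℓ t ⟩
      2 * k + 3                        ≡⟨ cong (λ k → 2 * k + 3) w+u≡k ⟨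
      2 * (w + u) + 3                  ≡⟨ identity₂ w u ⟩
      suc (w + suc (2 * u)) + suc w    ∎)
      where
      open ≡-Reasoning
      identity₁ : ∀ ℓ t → 2 * ℓ + (1 + t * 2) + 2 ≡ 2 * (ℓ + t) + 3
      identity₁ = solve-∀
      identity₂ : ∀ w u → 2 * (w + u) + 3 ≡ suc (w + suc (2 * u)) + suc w
      identity₂ = solve-∀

    last-index : ℓ + (1 + t * 2 + 1) / 2 ≡ suc k
    last-index = trans (cong (ℓ +_) ([1+2t+1]/2≡1+t t)) (+-suc ℓ t)

  y2-bound : DCond ℓ F (1 + t * 2) → TightY2Bound F (RA ⊓ RB) (2 * k) k
  y2-bound (inj₁ (even , _)) = ⊥-elim (0≢1+n (trans (sym even) ([m+kn]%n≡m%n 1 t 2)))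
  y2-bound (inj₂ (_ , inj₁ ∉F)) = caseA (subst (¬_ ∘ PairIn F 1) first-partner ∉F)
  y2-bound (inj₂ (_ , inj₂ (suc w , s≤s 2≤w , i≤ , ∉F)))
    with m≤n⇒∃[o]m+o≡n (≤-pred (subst (suc w ≤_) last-index i≤))
  ... | zero  , w+0≡k = caseB (subst (λ v → ¬ PairIn F (suc v) (suc (v + 1))) (trans (sym (+-identityʳ w)) w+0≡k)
                                     (subst (¬_ ∘ PairIn F (suc w)) (partner w+0≡k) ∉F))
  ... | suc u , w+u≡k = caseX 2≤w (s≤s z≤n) (sym w+u≡k) (subst (¬_ ∘ PairIn F (suc w)) (partner w+u≡k) ∉F)

paperBound : ℕ → ℕ → ℕ → ℕ
paperBound ℓ c d = (((4 * ℓ + 3 * c + d ∸ 2) * (3 * c + 1 ∸ d)) / 2)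
                   ⊓ (((ℓ + 3 * c ∸ (d ∸ 1) / 2) * (ℓ + 3 * c ∸ (d + 1) / 2)) / 2)

paperBound-odd : ∀ ℓ t e → let k = ℓ + t; A = t + 3 * e + 2 in
  paperBound ℓ (suc (t + e)) (1 + t * 2) ≡ (suc A * (A + 4 * k) / 2) ⊓ ((A + k) * suc (A + k) / 2)
paperBound-odd ℓ t e = cong₂ (λ x y → (x / 2) ⊓ (y / 2))
  (trans (cong₂ _*_ (+⇒∸ (A + 4 * k) 2 (identity₁ ℓ t e)) (+⇒∸ (suc A) (1 + t * 2) (identity₂ t e)))
         (*-comm (A + 4 * k) (suc A)))
  (trans (cong₂ _*_ (trans (cong (ℓ + 3 * c ∸_) (m*n/n≡m t 2)) (+⇒∸ (suc (A + k)) t (identity₃ ℓ t e)))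
                    (trans (cong (ℓ + 3 * c ∸_) ([1+2t+1]/2≡1+t t)) (+⇒∸ (A + k) (suc t) (identity₄ ℓ t e))))
         (*-comm (suc (A + k)) (A + k)))
  where
  k = ℓ + t
  A = t + 3 * e + 2
  c = suc (t + e)
  identity₁ : ∀ ℓ t e → 4 * ℓ + 3 * suc (t + e) + (1 + t * 2) ≡ (t + 3 * e + 2 + 4 * (ℓ + t)) + 2
  identity₁ = solve-∀
  identity₂ : ∀ t e → 3 * suc (t + e) + 1 ≡ suc (t + 3 * e + 2) + (1 + t * 2)
  identity₂ = solve-∀
  identity₃ : ∀ ℓ t e → ℓ + 3 * suc (t + e) ≡ suc (t + 3 * e + 2 + (ℓ + t)) + t
  identity₃ = solve-∀
  identity₄ : ∀ ℓ t e → ℓ + 3 * suc (t + e) ≡ (t + 3 * e + 2 + (ℓ + t)) + suc t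
  identity₄ = solve-∀

half : ∀ {R X} → 2 * R ≡ X → X / 2 ≡ R
half {R} refl = trans (cong (_/ 2) (*-comm 2 R)) (m*n/n≡m R 2)

y2-bound-odd : ∀ {n} {F : Family n} → Shifted F → ∀ ℓ t e {c d} → 0 < ℓ →
               c ≡ suc (t + e) → d ≡ 1 + t * 2 → n ≡ 2 * ℓ + 3 * c → DCond ℓ F d →
               TightY2Bound F (paperBound ℓ c d) (2 * ℓ + d ∸ 1) (ℓ + (d ∸ 1) / 2)
y2-bound-odd {F = F} shifted ℓ t e 0<ℓ refl refl n≡ dcond =
  subst (λ m → TightY2Bound F m _ _) (sym bound≡)
    (subst₂ (TightY2Bound F _) (sym 2k≡) (sym k≡) (y2-bound dcond))
  where
  A = t + 3 * e + 2
  n≡′ : _ ≡ 2 * (ℓ + t) + suc A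
  n≡′ = trans n≡ (identity ℓ t e)
    where
    identity : ∀ ℓ t e → 2 * ℓ + 3 * suc (t + e) ≡ 2 * (ℓ + t) + suc (t + 3 * e + 2)
    identity = solve-∀
  open OddCase shifted ℓ t A 0<ℓ n≡′
  bound≡ : paperBound ℓ (suc (t + e)) (1 + t * 2) ≡ RA ⊓ RB
  bound≡ = trans (paperBound-odd ℓ t e) (cong₂ _⊓_ (half 2RA≡) (half 2RB≡))
  2k≡ : 2 * ℓ + (1 + t * 2) ∸ 1 ≡ 2 * k
  2k≡ = +⇒∸ (2 * k) 1 (identity ℓ t)
    where
    identity : ∀ ℓ t → 2 * ℓ + (1 + t * 2) ≡ 2 * (ℓ + t) + 1
    identity = solve-∀
  k≡ : ℓ + (1 + t * 2 ∸ 1) / 2 ≡ k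
  k≡ = cong (ℓ +_) (m*n/n≡m t 2)

odd⇒1+2t : ∀ {d} → d % 2 ≡ 1 → d ≡ 1 + d / 2 * 2
odd⇒1+2t {d} d%2≡1 = trans (m≡m%n+[m/n]*n d 2) (cong (_+ d / 2 * 2) d%2≡1)

n≡2ℓ+3c : ∀ {n} s ℓ c → n ≡ 2 * s + c → n + ℓ ≡ 3 * s → n ≡ 2 * ℓ + 3 * c
n≡2ℓ+3c {n} s ℓ c n≡2s+c n+ℓ≡3s =
  trans n≡2s+c (trans (cong (λ s → 2 * s + c) s≡c+ℓ) (identity₂ c ℓ))
  where
  identity₁ : ∀ s → 3 * s ≡ 2 * s + s
  identity₁ = solve-∀
  identity₂ : ∀ c ℓ → 2 * (c + ℓ) + c ≡ 2 * ℓ + 3 * c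
  identity₂ = solve-∀
  s≡c+ℓ : s ≡ c + ℓ
  s≡c+ℓ = +-cancelˡ-≡ (2 * s) _ _ (begin
    2 * s + s        ≡⟨ identity₁ s ⟨
    3 * s            ≡⟨ n+ℓ≡3s ⟨
    n + ℓ            ≡⟨ cong (_+ ℓ) n≡2s+c ⟩
    2 * s + c + ℓ    ≡⟨ +-assoc (2 * s) c ℓ ⟩
    2 * s + (c + ℓ)  ∎)
    where open ≡-Reasoning

lemma14 : (n s ℓ c : ℕ) → 0 < n → 0 < s → 0 < ℓ → 0 < c →
  n ≡ 2 * s + c → n + ℓ ≡ 3 * s →
  1 ≤ c → c ≤ s ∸ 1 → 1 ≤ ℓ → ℓ ≤ s ∸ 1 →
  (d : ℕ) → 0 < d → d % 2 ≡ 1 → d ≤ 2 * c →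
  (F : Family n) → Shifted F → DIs ℓ F d →
  let bound = (((4 * ℓ + 3 * c + d ∸ 2) * (3 * c + 1 ∸ d)) / 2)
              ⊓ (((ℓ + 3 * c ∸ (d ∸ 1) / 2) * (ℓ + 3 * c ∸ (d + 1) / 2)) / 2)
  in (bound ≤ y2 F)
     × (y2 F ≡ bound →
        Level2IsInitial F (2 * ℓ + d ∸ 1) ⊎ Level2HitsInitial F (ℓ + (d ∸ 1) / 2))
lemma14 n s ℓ c _ _ 0<ℓ _ n≡2s+c n+ℓ≡3s _ _ _ _ d _ d%2≡1 d≤2c F shifted (dcond , _) =
  y2-bound-odd shifted ℓ t e 0<ℓ (sym c≡) d≡ (n≡2ℓ+3c s ℓ c n≡2s+c n+ℓ≡3s) dcond
  where
  t = d / 2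
  d≡ : d ≡ 1 + t * 2
  d≡ = odd⇒1+2t d%2≡1
  t<c : t < c
  t<c = *-cancelʳ-< 2 t c (subst (t * 2 <_) (*-comm 2 c) (subst (_≤ 2 * c) d≡ d≤2c))
  e = proj₁ (m≤n⇒∃[o]m+o≡n t<c)
  c≡ : suc (t + e) ≡ c
  c≡ = proj₂ (m≤n⇒∃[o]m+o≡n t<c)
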